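{- Let $t$ be a positive integer and let $G$ be a connected graph with at least $t+2$ vertices and minimum degree $\delta(G)\geq t$. Then for every vertex $v$ of $G$, there is a path with at least $t+2$ vertices starting at $v$, unless $v$ is a cut vertex of a block of $G$ which is a clique with $t+1$ vertices.
   Context: A block of a graph is a maximal connected subgraph that has no cut vertex (of itself). -}

module Defs where

open import Data.Nat using (ℕ; zero; suc; _+_; _≤_)
open import Data.Fin using (Fin; zero; suc; toℕ)
open import Data.Unit using (⊤)
open import Data.Fin.Subset using (Subset; _∈_; _⊂_; ∣_∣)
open import Data.Vec using (tabulate)
open import Data.Product using (Σ; ∃; _×_; _,_)
open import Relation.Nullary using (¬_; Dec; does)
open import Relation.Binary.PropositionalEquality using (_≡_; _≢_)
open import Function.Definitions using (Injective)

record Graph (n : ℕ) : Set₁ where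
  field
    Adj    : Fin n → Fin n → Set
    adj?   : (u w : Fin n) → Dec (Adj u w)
    sym    : ∀ {u w} → Adj u w → Adj w u
    irrefl : ∀ {u} → ¬ Adj u u

module _ {n : ℕ} (G : Graph n) where
  open Graph G

  nbhd : Fin n → Subset n
  nbhd v = tabulate (λ u → does (adj? v u))

  degree : Fin n → ℕ
  degree v = ∣ nbhd v ∣

  MinDegree≥ : ℕ → Set
  MinDegree≥ t = ∀ v → t ≤ degree v

  data WalkIn (P : Fin n → Set) : Fin n → Fin n → Set where
    [_]  : ∀ {u} → P u → WalkIn P u u
    _∷_  : ∀ {u x w} → P u → Adj u x → WalkIn P x w → WalkIn P u w

  Connected : Set
  Connected = ∀ u w → WalkIn (λ _ → ⊤) u w

  -- v is a cut vertex of the subgraph induced by P (with v satisfying P):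
  -- there are two vertices other than v joined by a walk in G[P] but not in G[P] - v,
  -- i.e. removing v increases the number of connected components.
  CutVertexIn : (P : Fin n → Set) → Fin n → Set
  CutVertexIn P v = P v × ∃ λ u → ∃ λ w → u ≢ v × w ≢ v × P u × P w
                    × WalkIn P u w × ¬ WalkIn (λ x → P x × x ≢ v) u w

  CutVertex : Fin n → Set
  CutVertex v = CutVertexIn (λ _ → ⊤) v

  Connected2 : Subset n → Set
  Connected2 S = (∀ u w → u ∈ S → w ∈ S → WalkIn (_∈ S) u w)
               × (∀ v → ¬ CutVertexIn (_∈ S) v)

  -- a block: a maximal connected subgraph without cut vertex
  -- (maximal subgraphs with this property are induced, so we use vertex sets)
  Block : Subset n → Set
  Block S = Connected2 S × (∀ S′ → S ⊂ S′ → ¬ Connected2 S′)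

  IsClique : Subset n → Set
  IsClique S = ∀ u w → u ∈ S → w ∈ S → u ≢ w → Adj u w

  PathFrom : Fin n → ℕ → Set
  PathFrom v k = Σ (Fin k → Fin n) λ p → Injective _≡_ _≡_ p
               × (∀ (i : Fin k) (j : Fin k) → suc (toℕ i) ≡ toℕ j → Adj (p i) (p j))
               × (∀ (i : Fin k) → toℕ i ≡ 0 → p i ≡ v)

-- Extend a path from v greedily.  If it gets stuck before reaching t + 2 vertices, all of the
-- at least t neighbours of its end lie on it, so it has exactly t + 1 vertices; call their set K.
-- Rotating the path (the current end jumps over the already treated vertices, which are adjacent
-- to all of K) makes every vertex of K other than v in turn the end of a path on K from v.
-- Each such end either has a neighbour outside K, giving a path with t + 2 vertices, or has
-- closed neighbourhood exactly K.  In the latter case K is a (t + 1)-clique in which only v has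
-- neighbours outside K; as n ≥ t + 2 and G is connected, v is a cut vertex and K a block.
module Submission where

open import Data.Empty using (⊥-elim)
open import Data.Fin using (Fin; zero; suc; toℕ; opposite)
open import Data.Fin.Properties
  using (any?; opposite-prop; opposite-involutive; toℕ<n; toℕ-fromℕ) renaming (_≟_ to _≟ᶠ_)
open import Data.Fin.Subset using (Subset; _∈_; _∉_; _⊂_; _⊆_; ∣_∣; ⁅_⁆; _∪_; _-_; ⊤; ⊥; inside; outside)
open import Data.Fin.Subset.Properties
  using (_∈?_; x∈⁅x⁆; x∈⁅y⁆⇒x≡y; x∈p∪q⁺; x∈p∪q⁻; ∉⊥; ∪-identityˡ; ∣⊥∣≡0; ∣⊤∣≡n;
         p⊆q⇒∣p∣≤∣q∣; p⊂q⇒∣p∣<∣q∣; x∈p⇒∣p-x∣<∣p∣; x∈p∧x≢y⇒x∈p-y)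
open import Data.List using (List; []; _∷_; _++_; length; lookup)
open import Data.List.Membership.Propositional using () renaming (_∈_ to _∈ₗ_; _∉_ to _∉ₗ_)
open import Data.List.Membership.Propositional.Properties using (∈-++⁺ʳ; ∈-++⁻; ∈-lookup)
open import Data.List.Relation.Binary.Permutation.Propositional using (_↭_; ↭-refl; ↭-sym; ↭-trans; ↭⇒↭ₛ)
open import Data.List.Relation.Binary.Permutation.Propositional.Properties using (↭-length; ∈-resp-↭; shift)
import Data.List.Relation.Binary.Permutation.Setoid.Properties as Permutationₛ
open import Data.List.Relation.Unary.All as All using (All; []; _∷_)
open import Data.List.Relation.Unary.Any using (here; there)
open import Data.List.Relation.Unary.Linked as Linked using (Linked; [-]; _∷_)
open import Data.List.Relation.Unary.Unique.Propositional using (Unique; []; _∷_)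
open import Data.List.Relation.Unary.Unique.Propositional.Properties using (Unique[x∷xs]⇒x∉xs)
open import Data.Nat using (ℕ; zero; suc; _+_; _∸_; _≤_; _<_; s≤s)
open import Data.Nat.Properties
  using (≤-refl; ≤-trans; ≤-reflexive; ≤-antisym; <⇒≱; 1+n≰n; ≰⇒>; m<1+n⇒m≤n; suc-injective;
         +-comm; +-assoc; +-suc; +-cancelʳ-≡; m∸n+n≡m; _≤?_)
open import Data.Product using (∃; _×_; _,_; proj₁; proj₂)
open import Data.Sum as Sum using (_⊎_; inj₁; inj₂)
open import Data.Unit using (tt)
open import Data.Vec using (_∷_; here; there)
open import Data.Vec.Properties using (lookup∘tabulate; []=⇒lookup)
open import Function using (_∘_; id; Injective)
open import Relation.Binary.PropositionalEquality as ≡ using (_≡_; _≢_; refl; sym; trans; cong; subst)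
open import Relation.Nullary using (¬_; Dec; yes; no; contradiction)
open import Relation.Nullary.Decidable using (_×-dec_; ¬?; decidable-stable)

open import Defs

∣⁅x⁆∪p∣≡1+∣p∣ : ∀ {n} {x : Fin n} {p} → x ∉ p → ∣ ⁅ x ⁆ ∪ p ∣ ≡ suc ∣ p ∣
∣⁅x⁆∪p∣≡1+∣p∣ {x = zero}  {outside ∷ p} _   = cong (suc ∘ ∣_∣) (∪-identityˡ p)
∣⁅x⁆∪p∣≡1+∣p∣ {x = zero}  {inside  ∷ p} x∉p = ⊥-elim (x∉p here)
∣⁅x⁆∪p∣≡1+∣p∣ {x = suc x} {outside ∷ p} x∉p = ∣⁅x⁆∪p∣≡1+∣p∣ (x∉p ∘ there)
∣⁅x⁆∪p∣≡1+∣p∣ {x = suc x} {inside  ∷ p} x∉p = cong suc (∣⁅x⁆∪p∣≡1+∣p∣ (x∉p ∘ there))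

∣p∣<n⇒∃∉ : ∀ {n} {p : Subset n} → ∣ p ∣ < n → ∃ λ x → x ∉ p
∣p∣<n⇒∃∉ {n} {p} ∣p∣<n with any? (λ x → ¬? (x ∈? p))
... | yes ∃∉ = ∃∉
... | no ∄∉  = contradiction (≤-trans (≤-reflexive (sym (∣⊤∣≡n n))) (p⊆q⇒∣p∣≤∣q∣ ⊤⊆p)) (<⇒≱ ∣p∣<n)
  where
  ⊤⊆p : ⊤ ⊆ p
  ⊤⊆p {x} _ = decidable-stable (x ∈? p) (λ x∉p → ∄∉ (x , x∉p))

module _ {n : ℕ} where

  ⟦_⟧ : List (Fin n) → Subset n
  ⟦ [] ⟧     = ⊥
  ⟦ x ∷ xs ⟧ = ⁅ x ⁆ ∪ ⟦ xs ⟧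

  ∈⟦⟧⁺ : ∀ {x xs} → x ∈ₗ xs → x ∈ ⟦ xs ⟧
  ∈⟦⟧⁺ (here refl)  = x∈p∪q⁺ (inj₁ (x∈⁅x⁆ _))
  ∈⟦⟧⁺ (there x∈xs) = x∈p∪q⁺ (inj₂ (∈⟦⟧⁺ x∈xs))

  ∈⟦⟧⁻ : ∀ {x} xs → x ∈ ⟦ xs ⟧ → x ∈ₗ xs
  ∈⟦⟧⁻ []       x∈⊥ = contradiction x∈⊥ ∉⊥
  ∈⟦⟧⁻ (y ∷ ys) x∈  with x∈p∪q⁻ ⁅ y ⁆ ⟦ ys ⟧ x∈
  ... | inj₁ x∈⁅y⁆ = here (x∈⁅y⁆⇒x≡y y x∈⁅y⁆)
  ... | inj₂ x∈ys  = there (∈⟦⟧⁻ ys x∈ys)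

  ∣⟦⟧∣≡length : ∀ {xs} → Unique xs → ∣ ⟦ xs ⟧ ∣ ≡ length xs
  ∣⟦⟧∣≡length {[]}     []                = ∣⊥∣≡0 n
  ∣⟦⟧∣≡length {x ∷ xs} uniq@(_ ∷ uniq′) =
    trans (∣⁅x⁆∪p∣≡1+∣p∣ (Unique[x∷xs]⇒x∉xs uniq ∘ ∈⟦⟧⁻ xs)) (cong suc (∣⟦⟧∣≡length uniq′))

suc-toℕ-opposite+toℕ : ∀ {k} (i : Fin k) → suc (toℕ (opposite i)) + toℕ i ≡ k
suc-toℕ-opposite+toℕ {k} i = begin
  suc (toℕ (opposite i)) + toℕ i ≡⟨ sym (+-suc (toℕ (opposite i)) (toℕ i)) ⟩
  toℕ (opposite i) + suc (toℕ i) ≡⟨ cong (_+ suc (toℕ i)) (opposite-prop i) ⟩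
  k ∸ suc (toℕ i) + suc (toℕ i)  ≡⟨ m∸n+n≡m (toℕ<n i) ⟩
  k                              ∎
  where open ≡.≡-Reasoning

toℕ-opposite-pred : ∀ {k} {i j : Fin k} → suc (toℕ i) ≡ toℕ j → toℕ (opposite i) ≡ suc (toℕ (opposite j))
toℕ-opposite-pred {k} {i} {j} i+1≡j = suc-injective (+-cancelʳ-≡ (toℕ i) _ _ (begin
  suc (toℕ (opposite i)) + toℕ i       ≡⟨ suc-toℕ-opposite+toℕ i ⟩
  k                                    ≡⟨ sym (suc-toℕ-opposite+toℕ j) ⟩
  suc (toℕ (opposite j)) + toℕ j       ≡⟨ cong (suc (toℕ (opposite j)) +_) (sym i+1≡j) ⟩
  suc (toℕ (opposite j)) + suc (toℕ i) ≡⟨ +-suc (suc (toℕ (opposite j))) (toℕ i) ⟩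
  suc (suc (toℕ (opposite j))) + toℕ i ∎))
  where open ≡.≡-Reasoning

toℕ-opposite-first : ∀ {k} {i : Fin k} → toℕ i ≡ 0 → suc (toℕ (opposite i)) ≡ k
toℕ-opposite-first {suc k} {zero} _ = cong suc (toℕ-fromℕ k)

opposite-injective : ∀ {k} → Injective _≡_ _≡_ (opposite {k})
opposite-injective {x = i} {j} eq =
  trans (sym (opposite-involutive i)) (trans (cong opposite eq) (opposite-involutive j))

module _ {A : Set} where

  data EndsAt (v : A) : List A → Set where
    last : EndsAt v (v ∷ [])
    _∷_  : ∀ x {xs} → EndsAt v xs → EndsAt v (x ∷ xs)

  EndsAt-++ : ∀ {v} xs {ys} → EndsAt v ys → EndsAt v (xs ++ ys)
  EndsAt-++ []       ends = ends
  EndsAt-++ (x ∷ xs) ends = x ∷ EndsAt-++ xs ends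

  EndsAt⇒∈ : ∀ {v xs} → EndsAt v xs → v ∈ₗ xs
  EndsAt⇒∈ last       = here refl
  EndsAt⇒∈ (_ ∷ ends) = there (EndsAt⇒∈ ends)

  ↭-toFront : ∀ (U : List A) {b B Q} → U ++ b ∷ B ↭ Q → b ∷ U ++ B ↭ Q
  ↭-toFront U {b} {B} π = ↭-trans (↭-sym (shift b U B)) π

  head≢last : ∀ {v x xs} → Unique (x ∷ xs) → EndsAt v (x ∷ xs) → 0 < length xs → x ≢ v
  head≢last uniq (_ ∷ ends) _ refl = Unique[x∷xs]⇒x∉xs uniq (EndsAt⇒∈ ends)
  head≢last _    last       ()

  lookup-EndsAt : ∀ {v xs} → EndsAt v xs → (i : Fin (length xs)) → suc (toℕ i) ≡ length xs → lookup xs i ≡ v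
  lookup-EndsAt last             zero    _    = refl
  lookup-EndsAt (_ ∷ last)       zero    ()
  lookup-EndsAt (_ ∷ (_ ∷ _))    zero    ()
  lookup-EndsAt (_ ∷ ends)       (suc i) i+2≡ = lookup-EndsAt ends i (suc-injective i+2≡)

  lookup-injective : ∀ {xs : List A} → Unique xs → Injective _≡_ _≡_ (lookup xs)
  lookup-injective {_ ∷ _}  _          {zero}  {zero}  _  = refl
  lookup-injective {_ ∷ xs} (x∉xs ∷ _) {zero}  {suc j} eq = contradiction eq (All.lookup x∉xs (∈-lookup j))
  lookup-injective {_ ∷ xs} (x∉xs ∷ _) {suc i} {zero}  eq = contradiction (sym eq) (All.lookup x∉xs (∈-lookup i))
  lookup-injective {_ ∷ _}  (_ ∷ uniq) {suc i} {suc j} eq = cong suc (lookup-injective uniq eq)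

  Linked⇒lookup : ∀ {R : A → A → Set} {xs} → Linked R xs →
                  (i j : Fin (length xs)) → toℕ j ≡ suc (toℕ i) → R (lookup xs i) (lookup xs j)
  Linked⇒lookup (r ∷ _)  zero    (suc zero)    _     = r
  Linked⇒lookup (_ ∷ rs) (suc i) (suc (suc j)) j≡i+1 = Linked⇒lookup rs i (suc j) (suc-injective j≡i+1)
  Linked⇒lookup [-]      zero    zero          ()
  Linked⇒lookup (_ ∷ _)  zero    zero          ()
  Linked⇒lookup (_ ∷ _)  zero    (suc (suc _)) ()
  Linked⇒lookup (_ ∷ _)  (suc _) zero          ()
  Linked⇒lookup (_ ∷ _)  (suc _) (suc zero)    ()

module _ {n : ℕ} (G : Graph n) where
  open Graph G renaming (sym to Adj-sym)

  ∈nbhd⇒Adj : ∀ {v u} → u ∈ nbhd G v → Adj v u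
  ∈nbhd⇒Adj {v} {u} u∈N with adj? v u | trans (sym (lookup∘tabulate _ u)) ([]=⇒lookup u∈N)
  ... | yes vu | _ = vu
  ... | no _   | ()

  NeighboursIn : Fin n → Subset n → Set
  NeighboursIn e S = ∀ {w} → Adj e w → w ∈ S

  AdjacentToAll : Fin n → Subset n → Set
  AdjacentToAll e S = ∀ {w} → w ∈ S → w ≢ e → Adj e w

  ClosedNbhd : Fin n → Subset n → Set
  ClosedNbhd e S = NeighboursIn e S × AdjacentToAll e S

  ClosedNbhdsExcept : Fin n → Subset n → Set
  ClosedNbhdsExcept v K = ∀ {x} → x ∈ K → x ≢ v → ClosedNbhd x K

  degree<∣S∣ : ∀ {e S} → e ∈ S → NeighboursIn e S → degree G e < ∣ S ∣
  degree<∣S∣ e∈S N⊆S = p⊂q⇒∣p∣<∣q∣ ((N⊆S ∘ ∈nbhd⇒Adj) , _ , e∈S , irrefl ∘ ∈nbhd⇒Adj)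

  -- If e were not adjacent to w, N(e) would be a proper subset of S - w.
  adjacentToAll : ∀ {e S} → e ∈ S → NeighboursIn e S → ∣ S ∣ ≤ suc (degree G e) → AdjacentToAll e S
  adjacentToAll {e} {S} e∈S N⊆S ∣S∣≤1+deg {w} w∈S w≢e with adj? e w
  ... | yes ew = ew
  ... | no ¬ew =
    contradiction (≤-trans (s≤s (degree<∣S∣ e∈S-w N⊆S-w)) (≤-trans (x∈p⇒∣p-x∣<∣p∣ w∈S) ∣S∣≤1+deg)) 1+n≰n
    where
    e∈S-w : e ∈ S - w
    e∈S-w = x∈p∧x≢y⇒x∈p-y e∈S (w≢e ∘ sym)
    N⊆S-w : NeighboursIn e (S - w)
    N⊆S-w {x} ex = x∈p∧x≢y⇒x∈p-y (N⊆S ex) (λ x≡w → ¬ew (subst (Adj e) x≡w ex))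

  Extension : Fin n → Subset n → Set
  Extension e S = ∃ λ u → Adj e u × u ∉ S

  extension? : ∀ e S → Dec (Extension e S)
  extension? e S = any? (λ u → adj? e u ×-dec ¬? (u ∈? S))

  ¬Extension⇒NeighboursIn : ∀ {e S} → ¬ Extension e S → NeighboursIn e S
  ¬Extension⇒NeighboursIn {S = S} ¬ext {w} ew = decidable-stable (w ∈? S) (λ w∉S → ¬ext (w , ew , w∉S))

  -- A path from v, listed from its far end back to v.
  record IsPathTo (v : Fin n) (xs : List (Fin n)) : Set where
    field
      unique : Unique xs
      linked : Linked Adj xs
      endsAt : EndsAt v xs
  open IsPathTo

  singletonPath : ∀ {v} → IsPathTo v (v ∷ [])
  singletonPath = record { unique = [] ∷ [] ; linked = [-] ; endsAt = last }

  LongPathFrom : Fin n → ℕ → Set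
  LongPathFrom v m = ∃ λ k → m ≤ k × PathFrom G v k

  toPathFrom : ∀ {v xs} → IsPathTo v xs → PathFrom G v (length xs)
  toPathFrom {v} {xs} P = p , opposite-injective ∘ lookup-injective (unique P) , adjacent , starts
    where
    p : Fin (length xs) → Fin n
    p i = lookup xs (opposite i)
    adjacent : ∀ i j → suc (toℕ i) ≡ toℕ j → Adj (p i) (p j)
    adjacent i j i+1≡j =
      Adj-sym (Linked⇒lookup (linked P) (opposite j) (opposite i) (toℕ-opposite-pred i+1≡j))
    starts : ∀ i → toℕ i ≡ 0 → p i ≡ v
    starts i i≡0 = lookup-EndsAt (endsAt P) (opposite i) (toℕ-opposite-first i≡0)

  extend : ∀ {v e xs u} → IsPathTo v (e ∷ xs) → Adj e u → u ∉ₗ e ∷ xs → IsPathTo v (u ∷ e ∷ xs)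
  extend P eu u∉ = record
    { unique = All.tabulate (λ { x∈ refl → u∉ x∈ }) ∷ unique P
    ; linked = Adj-sym eu ∷ linked P
    ; endsAt = _ ∷ endsAt P
    }

  record MaximalPathFrom (v : Fin n) : Set where
    constructor maximal
    field
      end   : Fin n
      rest  : List (Fin n)
      path  : IsPathTo v (end ∷ rest)
      stuck : NeighboursIn end ⟦ end ∷ rest ⟧

  degree<length : ∀ {v e xs} → IsPathTo v (e ∷ xs) → NeighboursIn e ⟦ e ∷ xs ⟧ → degree G e < length (e ∷ xs)
  degree<length {e = e} {xs} P stuck =
    subst (degree G e <_) (∣⟦⟧∣≡length (unique P)) (degree<∣S∣ (∈⟦⟧⁺ {xs = e ∷ xs} (here refl)) stuck)

  extendGreedily : ∀ {v} f {e xs} → IsPathTo v (e ∷ xs) →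
                   LongPathFrom v (f + length (e ∷ xs)) ⊎ MaximalPathFrom v
  extendGreedily zero    {e} {xs} P = inj₁ (length (e ∷ xs) , ≤-refl , toPathFrom P)
  extendGreedily {v} (suc f) {e} {xs} P with extension? e ⟦ e ∷ xs ⟧
  ... | yes (u , eu , u∉) = Sum.map₁ (subst (LongPathFrom v) (+-suc f (length (e ∷ xs))))
                                      (extendGreedily f (extend P eu (u∉ ∘ ∈⟦⟧⁺)))
  ... | no ¬ext           = inj₂ (maximal e xs P (¬Extension⇒NeighboursIn ¬ext))

  linked-insertUniversal : ∀ {K} U {b c B} → All (λ u → AdjacentToAll u K) U →
                           All (_∈ K) (b ∷ U ++ c ∷ B) → Unique (b ∷ U ++ c ∷ B) →
                           Adj b c → Linked Adj (c ∷ B) → Linked Adj (b ∷ U ++ c ∷ B)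
  linked-insertUniversal []      _ _ _ bc cB = bc ∷ cB
  linked-insertUniversal (u ∷ U) {c = c} {B} (u~K ∷ U~K) (b∈K ∷ ∈K) ((b≢u ∷ _) ∷ uniq@(u∉ ∷ _)) _ cB =
    Adj-sym (u~K b∈K b≢u) ∷ linked-insertUniversal U U~K ∈K uniq uc cB
    where
    c∈ : c ∈ₗ U ++ c ∷ B
    c∈ = ∈-++⁺ʳ U (here refl)
    uc : Adj u c
    uc = u~K (All.lookup ∈K (there c∈)) (All.lookup u∉ c∈ ∘ sym)

  walk-confined : ∀ {v K} {P : Fin n → Set} {a b} → (∀ {x} → x ∈ K → x ≢ v → NeighboursIn x K) →
                  (∀ {x} → P x → x ≢ v) → WalkIn G P a b → a ∈ K → b ∈ K
  walk-confined sealed avoid [ _ ]            a∈K = a∈K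
  walk-confined sealed avoid (_∷_ Pa ax walk) a∈K =
    walk-confined sealed avoid walk (sealed a∈K (avoid Pa) ax)

  IsClique⇒Connected2 : ∀ {S} → IsClique G S → Connected2 G S
  IsClique⇒Connected2 {S} clique =
    (λ _ _ u∈S w∈S → edgeWalk id u∈S w∈S) ,
    (λ { z (_ , _ , _ , u≢z , w≢z , u∈S , w∈S , _ , ¬walk) →
           ¬walk (edgeWalk proj₁ (u∈S , u≢z) (w∈S , w≢z)) })
    where
    edgeWalk : ∀ {P : Fin n → Set} → (∀ {x} → P x → x ∈ S) → ∀ {u w} → P u → P w → WalkIn G P u w
    edgeWalk P⊆S {u} {w} Pu Pw with u ≟ᶠ w
    ... | yes refl = [ Pu ]
    ... | no u≢w   = _∷_ Pu (clique u w (P⊆S Pu) (P⊆S Pw) u≢w) [ Pw ]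

  record PendantClique (v : Fin n) (K : Subset n) : Set where
    field
      v∈K     : v ∈ K
      other   : Fin n
      other∈K : other ∈ K
      other≢v : other ≢ v
      closed  : ClosedNbhdsExcept v K

  module _ {v K} (pendant : PendantClique v K) where
    open PendantClique pendant

    pendant⇒CutVertexIn : ∀ {P : Fin n → Set} {x} → P v → P other → P x → x ∉ K →
                          WalkIn G P other x → CutVertexIn G P v
    pendant⇒CutVertexIn Pv Pother Px x∉K walk =
      Pv , other , _ , other≢v , (λ x≡v → x∉K (subst (_∈ K) (sym x≡v) v∈K)) , Pother , Px , walk ,
      λ walk′ → x∉K (walk-confined (λ x∈K x≢v → proj₁ (closed x∈K x≢v)) proj₂ walk′ other∈K)

    pendant⇒IsClique : IsClique G K
    pendant⇒IsClique x y x∈K y∈K x≢y with x ≟ᶠ v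
    ... | no x≢v   = proj₂ (closed x∈K x≢v) y∈K (x≢y ∘ sym)
    ... | yes refl = Adj-sym (proj₂ (closed y∈K (x≢y ∘ sym)) x∈K x≢y)

    pendant⇒Block : Block G K
    pendant⇒Block = IsClique⇒Connected2 pendant⇒IsClique , isMaximal
      where
      isMaximal : ∀ S′ → K ⊂ S′ → ¬ Connected2 G S′
      isMaximal S′ (K⊆S′ , x , x∈S′ , x∉K) (connected , noCut) =
        noCut v (pendant⇒CutVertexIn (K⊆S′ v∈K) (K⊆S′ other∈K) x∈S′ x∉K
                                     (connected _ _ (K⊆S′ other∈K) x∈S′))

    pendant⇒cliqueBlock : ∀ {m} → Connected G → ∣ K ∣ ≡ m → m < n →
                          CutVertex G v × ∃ λ B → Block G B × IsClique G B × ∣ B ∣ ≡ m × v ∈ B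
    pendant⇒cliqueBlock connected refl ∣K∣<n with ∣p∣<n⇒∃∉ ∣K∣<n
    ... | x , x∉K =
      pendant⇒CutVertexIn tt tt tt x∉K (connected other x) ,
      K , pendant⇒Block , pendant⇒IsClique , refl , v∈K

module _ {n : ℕ} (G : Graph n) {t : ℕ} (δ≥t : MinDegree≥ G t) where
  open Graph G renaming (sym to Adj-sym)
  open IsPathTo
  open Permutationₛ (≡.setoid (Fin n)) using (Unique-resp-↭)

  module Rotation (v : Fin n) (Q : List (Fin n)) (uniqueQ : Unique Q) (∣Q∣≡t+1 : length Q ≡ t + 1) where

    K : Subset n
    K = ⟦ Q ⟧

    ↭Q⇒∈K : ∀ {L x} → L ↭ Q → x ∈ₗ L → x ∈ K
    ↭Q⇒∈K π = ∈⟦⟧⁺ ∘ ∈-resp-↭ π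

    closedNbhd : ∀ {x} → x ∈ K → NeighboursIn G x K → ClosedNbhd G x K
    closedNbhd {x} x∈K N⊆K = N⊆K , adjacentToAll G x∈K N⊆K ∣K∣≤1+deg
      where
      ∣K∣≤1+deg : ∣ K ∣ ≤ suc (degree G x)
      ∣K∣≤1+deg =
        ≤-trans (≤-reflexive (trans (∣⟦⟧∣≡length uniqueQ) (trans ∣Q∣≡t+1 (+-comm t 1)))) (s≤s (δ≥t x))

    rotatedPath : ∀ U {b c B} → b ∷ U ++ c ∷ B ↭ Q → All (λ u → ClosedNbhd G u K) U →
                  Linked Adj (b ∷ c ∷ B) → EndsAt v (c ∷ B) → IsPathTo G v (b ∷ U ++ c ∷ B)
    rotatedPath U {b} {c} {B} π closedU (bc ∷ cB) ends = record
      { unique = uniqueR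
      ; linked = linked-insertUniversal G U (All.map proj₂ closedU) (All.tabulate (↭Q⇒∈K π)) uniqueR bc cB
      ; endsAt = b ∷ EndsAt-++ U ends
      }
      where
      uniqueR : Unique (b ∷ U ++ c ∷ B)
      uniqueR = Unique-resp-↭ (↭⇒↭ₛ (↭-sym π)) uniqueQ

    -- U ++ b ∷ B orders Q so that b ∷ B is a path to v.  As every vertex of U is adjacent to all
    -- of K, b ∷ U ++ c ∷ B is again a path to v, now ending at b.
    rotate : ∀ U b B → U ++ b ∷ B ↭ Q → All (λ u → ClosedNbhd G u K) U →
             Linked Adj (b ∷ B) → EndsAt v (b ∷ B) → LongPathFrom G v (t + 2) ⊎ ClosedNbhdsExcept G v K
    rotate U _ [] π closedU _ last =
      inj₂ λ x∈K x≢v → All.lookup closedU (∈U (∈-resp-↭ (↭-sym π) (∈⟦⟧⁻ Q x∈K)) x≢v)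
      where
      ∈U : ∀ {x} → x ∈ₗ U ++ v ∷ [] → x ≢ v → x ∈ₗ U
      ∈U x∈ x≢v with ∈-++⁻ U x∈
      ... | inj₁ x∈U        = x∈U
      ... | inj₂ (here x≡v) = contradiction x≡v x≢v
    rotate U b (c ∷ B) π closedU bcB (_ ∷ ends) with extension? G b K
    ... | yes (u , bu , u∉K) =
      inj₁ (_ , t+2≤ , toPathFrom G (extend G (rotatedPath U π′ closedU bcB ends) bu (u∉K ∘ ↭Q⇒∈K π′)))
      where
      π′ : b ∷ U ++ c ∷ B ↭ Q
      π′ = ↭-toFront U π
      t+2≤ : t + 2 ≤ length (u ∷ b ∷ U ++ c ∷ B)
      t+2≤ = ≤-reflexive (trans (+-suc t 1) (cong suc (sym (trans (↭-length π′) ∣Q∣≡t+1))))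
    ... | no ¬ext =
      rotate (b ∷ U) c B (↭-toFront U π) (closedNbhd b∈K (¬Extension⇒NeighboursIn G ¬ext) ∷ closedU)
             (Linked.tail bcB) ends
      where
      b∈K : b ∈ K
      b∈K = ↭Q⇒∈K π (∈-++⁺ʳ U (here refl))

  longPathOrPendantClique : ∀ {v} → 1 ≤ t → MaximalPathFrom G v →
                            LongPathFrom G v (t + 2) ⊎ ∃ λ K → ∣ K ∣ ≡ t + 1 × PendantClique G v K
  longPathOrPendantClique {v} 1≤t (maximal e xs P stuck) with t + 2 ≤? length (e ∷ xs)
  ... | yes long = inj₁ (_ , long , toPathFrom G P)
  ... | no short = Sum.map₂ pendant (rotate [] e xs ↭-refl [] (linked P) (endsAt P))
    where
    length≡ : length (e ∷ xs) ≡ t + 1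
    length≡ = ≤-antisym (m<1+n⇒m≤n (subst (length (e ∷ xs) <_) (+-suc t 1) (≰⇒> short)))
                        (subst (_≤ length (e ∷ xs)) (+-comm 1 t)
                               (≤-trans (s≤s (δ≥t e)) (degree<length G P stuck)))
    open Rotation v (e ∷ xs) (unique P) length≡
    e≢v : e ≢ v
    e≢v = head≢last (unique P) (endsAt P)
                    (subst (0 <_) (suc-injective (trans (+-comm 1 t) (sym length≡))) 1≤t)
    pendant : ClosedNbhdsExcept G v K → ∃ λ K → ∣ K ∣ ≡ t + 1 × PendantClique G v K
    pendant closed = K , trans (∣⟦⟧∣≡length (unique P)) length≡ , record
      { v∈K     = ∈⟦⟧⁺ (EndsAt⇒∈ (endsAt P))
      ; other   = e
      ; other∈K = ∈⟦⟧⁺ {xs = e ∷ xs} (here refl)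
      ; other≢v = e≢v
      ; closed  = closed
      }

lemma2p11 : (t : ℕ) → 1 ≤ t → (n : ℕ) → (G : Graph n) → Connected G → t + 2 ≤ n → MinDegree≥ G t → (v : Fin n) → ¬ (CutVertex G v × ∃ λ (B : Subset n) → Block G B × IsClique G B × ∣ B ∣ ≡ t + 1 × v ∈ B) → ∃ λ k → t + 2 ≤ k × PathFrom G v k
lemma2p11 t 1≤t n G connected t+2≤n δ≥t v ¬cliqueBlock with extendGreedily G (t + 1) (singletonPath G)
... | inj₁ long = subst (LongPathFrom G v) (+-assoc t 1 1) long
... | inj₂ maximalPath with longPathOrPendantClique G δ≥t 1≤t maximalPath
...   | inj₁ long = long
...   | inj₂ (K , ∣K∣≡t+1 , pendant) =
    contradiction (pendant⇒cliqueBlock G pendant connected ∣K∣≡t+1 (subst (_≤ n) (+-suc t 1) t+2≤n))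
                  ¬cliqueBlock
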